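{- Let $P,Q\in\mathbb{Z}$ with $PQ\neq 0$, let $p$ be a prime dividing both $P$ and $Q$, and write $P=p^aP'$, $Q=p^bQ'$ with $a,b\geq 1$ and $p\nmid P'Q'$. If $b>2a$ and $r\geq 1$ is an integer, then $\mathcal{L}(P,Q,p^{ -r})=S_{\lceil (r+a)/a\rceil}$.
   Context: $\mathbb{N}=\{0,1,2,\ldots\}$. For $P,Q\in\mathbb{Z}$, the Lucas sequence $U_n=U_n(P,Q)$ is defined by $U_0=0$, $U_1=1$, $U_{n+2}=PU_{n+1}-QU_n$. For $R\in\mathbb{Q}$, $\mathcal{L}(P,Q,R)=\{n\in\mathbb{N} : U_nR\in\mathbb{Z}\}$. For $m\geq 1$, $S_m=\{0,m,m+1,m+2,\ldots\}$. -}

module Defs where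

open import Data.Nat as ℕ using (ℕ; zero; suc)
open import Data.Integer as ℤ using (ℤ; +_)
open import Data.Rational as ℚ using (ℚ)
open import Data.Product using (∃)
open import Data.Sum using (_⊎_)
open import Relation.Binary.PropositionalEquality using (_≡_)

U : ℤ → ℤ → ℕ → ℤ
U P Q zero = + 0
U P Q (suc zero) = + 1
U P Q (suc (suc n)) = P ℤ.* U P Q (suc n) ℤ.- Q ℤ.* U P Q n

_∈𝓛[_,_,_] : ℕ → ℤ → ℤ → ℚ → Set
n ∈𝓛[ P , Q , R ] = ∃ λ (z : ℤ) → ℚ._*_ (ℚ._/_ (U P Q n) 1) R ≡ ℚ._/_ z 1

_∈S[_] : ℕ → ℕ → Set
n ∈S[ m ] = n ≡ 0 ⊎ m ℕ.≤ n

open import Data.Nat.Primality using (Prime; prime⇒nonZero)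
open import Data.Nat.Properties using (m^n≢0)

invPrimePow : (p : ℕ) → Prime p → ℕ → ℚ
invPrimePow p pp r = ℚ._/_ (+ 1) (p ℕ.^ r) {{m^n≢0 p r {{prime⇒nonZero pp}}}}

⌈_/_⌉[_] : ℕ → (a : ℕ) → 1 ℕ.≤ a → ℤ
⌈ x / a ⌉[ h ] = ℚ.ceiling (ℚ._/_ (+ x) a {{ℕ.>-nonZero h}})

-- Pulling p^a out of P and (p^a)^2 out of Q (possible as b > 2a) gives the
-- homogeneity identity U_{n+1}(P,Q) = p^(an) U_{n+1}(P',T) with T = p^(b-2a) Q'.
-- Since p ∤ P' and p ∣ T, the recurrence shows p ∤ U_{n+1}(P',T), so the
-- p-adic valuation of U_{n+1}(P,Q) is exactly an. Hence U_n p^(-r) is an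
-- integer iff n = 0 or r ≤ a(n-1), i.e. iff n = 0 or n ≥ ⌈(r+a)/a⌉.
module Submission where

open import Defs
open import Data.Nat as ℕ using (ℕ; zero; suc; _^_; _≤_; _<_; _*_; _+_)
import Data.Nat.Properties as ℕP
import Data.Nat.Tactic.RingSolver as ℕSolver
import Data.Nat.GCD as ℕG
import Data.Nat.Divisibility as ℕD
open import Data.Nat.Primality using (Prime; euclidsLemma; prime⇒nonZero; ¬prime[1])
open import Data.Integer as ℤ using (ℤ; +_; -[1+_])
import Data.Integer.Properties as ℤP
import Data.Integer.DivMod as ℤDM
open import Data.Integer.Divisibility as ℤD using ()
import Data.Integer.Divisibility.Signed as ℤS
open import Data.Integer.Tactic.RingSolver using (solve-∀)
open import Data.Rational as ℚ using (↥_; ↧_; ↧ₙ_; mkℚ)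
import Data.Rational.Properties as ℚP
import Data.Rational.Unnormalised as ℚᵘ
import Data.Rational.Unnormalised.Properties as ℚᵘP
open import Data.Product using (_×_; Σ; _,_)
open import Data.Sum using (_⊎_; inj₁; inj₂; [_,_])
open import Data.Empty using (⊥-elim)
open import Function.Bundles using (_⇔_; mk⇔; Equivalence)
import Function.Properties.Equivalence as ⇔
open import Relation.Nullary using (¬_; yes; no)
open import Relation.Binary.PropositionalEquality
  using (_≡_; _≢_; refl; sym; trans; cong; cong₂; subst; module ≡-Reasoning)

open Equivalence using (to; from)

U-homogeneous : ∀ A P Q n → U (A ℤ.* P) (A ℤ.* A ℤ.* Q) (suc n) ≡ A ℤ.^ n ℤ.* U P Q (suc n)
U-homogeneous A P Q zero = refl
U-homogeneous A P Q (suc zero) = base A P Q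
  where
  base : ∀ A P Q → A ℤ.* P ℤ.* + 1 ℤ.- A ℤ.* A ℤ.* Q ℤ.* + 0 ≡ A ℤ.* + 1 ℤ.* (P ℤ.* + 1 ℤ.- Q ℤ.* + 0)
  base = solve-∀
U-homogeneous A P Q (suc (suc n)) = begin
  A ℤ.* P ℤ.* U (A ℤ.* P) (A ℤ.* A ℤ.* Q) (suc (suc n)) ℤ.- A ℤ.* A ℤ.* Q ℤ.* U (A ℤ.* P) (A ℤ.* A ℤ.* Q) (suc n)
    ≡⟨ cong₂ (λ u v → A ℤ.* P ℤ.* u ℤ.- A ℤ.* A ℤ.* Q ℤ.* v) (U-homogeneous A P Q (suc n)) (U-homogeneous A P Q n) ⟩
  A ℤ.* P ℤ.* (A ℤ.* A ℤ.^ n ℤ.* U P Q (suc (suc n))) ℤ.- A ℤ.* A ℤ.* Q ℤ.* (A ℤ.^ n ℤ.* U P Q (suc n))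
    ≡⟨ regroup A (A ℤ.^ n) P Q (U P Q (suc (suc n))) (U P Q (suc n)) ⟩
  A ℤ.* (A ℤ.* A ℤ.^ n) ℤ.* (P ℤ.* U P Q (suc (suc n)) ℤ.- Q ℤ.* U P Q (suc n)) ∎
  where
  open ≡-Reasoning
  regroup : ∀ A x P Q u v → A ℤ.* P ℤ.* (A ℤ.* x ℤ.* u) ℤ.- A ℤ.* A ℤ.* Q ℤ.* (x ℤ.* v)
                          ≡ A ℤ.* (A ℤ.* x) ℤ.* (P ℤ.* u ℤ.- Q ℤ.* v)
  regroup = solve-∀

+-^ : ∀ m n → + (m ^ n) ≡ (+ m) ℤ.^ n
+-^ m zero = refl
+-^ m (suc n) = trans (ℤP.pos-* m (m ^ n)) (cong (+ m ℤ.*_) (+-^ m n))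

U-pullout : ∀ {P Q P' Q'} π a e → P ≡ π ℤ.^ a ℤ.* P' → Q ≡ π ℤ.^ (a + a + e) ℤ.* Q' →
  ∀ n → U P Q (suc n) ≡ π ℤ.^ (a * n) ℤ.* U P' (π ℤ.^ e ℤ.* Q') (suc n)
U-pullout {P' = P'} {Q'} π a e refl refl n = begin
  U (π ℤ.^ a ℤ.* P') (π ℤ.^ (a + a + e) ℤ.* Q') (suc n)
    ≡⟨ cong (λ Q → U (π ℤ.^ a ℤ.* P') Q (suc n)) Q-split ⟩
  U (π ℤ.^ a ℤ.* P') (π ℤ.^ a ℤ.* π ℤ.^ a ℤ.* (π ℤ.^ e ℤ.* Q')) (suc n)
    ≡⟨ U-homogeneous (π ℤ.^ a) P' (π ℤ.^ e ℤ.* Q') n ⟩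
  (π ℤ.^ a) ℤ.^ n ℤ.* U P' (π ℤ.^ e ℤ.* Q') (suc n)
    ≡⟨ cong (ℤ._* U P' (π ℤ.^ e ℤ.* Q') (suc n)) (ℤP.^-*-assoc π a n) ⟩
  π ℤ.^ (a * n) ℤ.* U P' (π ℤ.^ e ℤ.* Q') (suc n) ∎
  where
  open ≡-Reasoning
  Q-split : π ℤ.^ (a + a + e) ℤ.* Q' ≡ π ℤ.^ a ℤ.* π ℤ.^ a ℤ.* (π ℤ.^ e ℤ.* Q')
  Q-split = begin
    π ℤ.^ (a + a + e) ℤ.* Q'                    ≡⟨ cong (ℤ._* Q') (ℤP.^-distribˡ-+-* π (a + a) e) ⟩
    π ℤ.^ (a + a) ℤ.* π ℤ.^ e ℤ.* Q'            ≡⟨ cong (λ y → y ℤ.* π ℤ.^ e ℤ.* Q') (ℤP.^-distribˡ-+-* π a a) ⟩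
    π ℤ.^ a ℤ.* π ℤ.^ a ℤ.* π ℤ.^ e ℤ.* Q'      ≡⟨ ℤP.*-assoc (π ℤ.^ a ℤ.* π ℤ.^ a) (π ℤ.^ e) Q' ⟩
    π ℤ.^ a ℤ.* π ℤ.^ a ℤ.* (π ℤ.^ e ℤ.* Q')    ∎

prime∣*⇒∣⊎∣ : ∀ {p} → Prime p → ∀ x y → + p ℤS.∣ x ℤ.* y → + p ℤS.∣ x ⊎ + p ℤS.∣ y
prime∣*⇒∣⊎∣ {p} pp x y p∣xy =
  [ (λ h → inj₁ (ℤS.∣ᵤ⇒∣ h)) , (λ h → inj₂ (ℤS.∣ᵤ⇒∣ h)) ]
  (euclidsLemma ℤ.∣ x ∣ ℤ.∣ y ∣ pp (subst (p ℕD.∣_) (ℤP.abs-* x y) (ℤS.∣⇒∣ᵤ p∣xy)))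

prime∤U : ∀ {p P Q} → Prime p → ¬ (+ p ℤS.∣ P) → + p ℤS.∣ Q → ∀ n → ¬ (+ p ℤS.∣ U P Q (suc n))
prime∤U pp p∤P p∣Q zero p∣1 = ¬prime[1] (subst Prime (ℕD.∣1⇒≡1 (ℤS.∣⇒∣ᵤ p∣1)) pp)
prime∤U {p} {P} {Q} pp p∤P p∣Q (suc n) p∣U =
  [ p∤P , prime∤U pp p∤P p∣Q n ] (prime∣*⇒∣⊎∣ pp P (U P Q (suc n)) p∣PU)
  where
  p∣PU : + p ℤS.∣ P ℤ.* U P Q (suc n)
  p∣PU = ℤS.∣m+n∣n⇒∣m p∣U (ℤS.∣m⇒∣-m (ℤS.∣m⇒∣m*n (U P Q n) p∣Q))

^-monoʳ-∣ : ∀ p {r e} → r ≤ e → p ^ r ℕD.∣ p ^ e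
^-monoʳ-∣ p {r} {e} r≤e = subst (p ^ r ℕD.∣_) p^r*p^[e∸r]≡p^e (ℕD.m∣m*n (p ^ (e ℕ.∸ r)))
  where
  p^r*p^[e∸r]≡p^e : p ^ r * p ^ (e ℕ.∸ r) ≡ p ^ e
  p^r*p^[e∸r]≡p^e = trans (sym (ℕP.^-distribˡ-+-* p r (e ℕ.∸ r))) (cong (p ^_) (ℕP.m+[n∸m]≡n r≤e))

prime^∣^*⇔≤ : ∀ {p w} r e → Prime p → ¬ (p ℕD.∣ w) → (p ^ r ℕD.∣ p ^ e * w) ⇔ (r ≤ e)
prime^∣^*⇔≤ {p} {w} r e pp p∤w = mk⇔ p^r∣⇒r≤e (λ r≤e → ℕD.∣-trans (^-monoʳ-∣ p r≤e) (ℕD.m∣m*n w))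
  where
  instance
    p^e≢0 : ℕ.NonZero (p ^ e)
    p^e≢0 = ℕP.m^n≢0 p e {{prime⇒nonZero pp}}
  p^r∣⇒r≤e : p ^ r ℕD.∣ p ^ e * w → r ≤ e
  p^r∣⇒r≤e p^r∣ with r ℕ.≤? e
  ... | yes r≤e = r≤e
  ... | no r≰e = ⊥-elim (p∤w (ℕD.*-cancelˡ-∣ (p ^ e) p^e*p∣p^e*w))
    where
    p^e*p∣p^e*w : p ^ e * p ℕD.∣ p ^ e * w
    p^e*p∣p^e*w = subst (ℕD._∣ p ^ e * w) (ℕP.*-comm p (p ^ e)) (ℕD.∣-trans (^-monoʳ-∣ p (ℕP.≰⇒> r≰e)) p^r∣)

fromℚᵘ-homo-* : ∀ u v → ℚ.fromℚᵘ (u ℚᵘ.* v) ≡ ℚ.fromℚᵘ u ℚ.* ℚ.fromℚᵘ v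
fromℚᵘ-homo-* u v = ℚP.toℚᵘ-injective (begin
  ℚ.toℚᵘ (ℚ.fromℚᵘ (u ℚᵘ.* v))              ≈⟨ ℚP.toℚᵘ-fromℚᵘ (u ℚᵘ.* v) ⟩
  u ℚᵘ.* v                                    ≈⟨ ℚᵘP.*-cong (ℚᵘP.≃-sym (ℚP.toℚᵘ-fromℚᵘ u)) (ℚᵘP.≃-sym (ℚP.toℚᵘ-fromℚᵘ v)) ⟩
  ℚ.toℚᵘ (ℚ.fromℚᵘ u) ℚᵘ.* ℚ.toℚᵘ (ℚ.fromℚᵘ v) ≈⟨ ℚᵘP.≃-sym (ℚP.toℚᵘ-homo-* (ℚ.fromℚᵘ u) (ℚ.fromℚᵘ v)) ⟩
  ℚ.toℚᵘ (ℚ.fromℚᵘ u ℚ.* ℚ.fromℚᵘ v)         ∎)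
  where open ℚᵘP.≃-Reasoning

-- x / suc k is by definition fromℚᵘ (mkℚᵘ x k).
x/1*1/d≡x/d : ∀ x k → (x ℚ./ 1) ℚ.* (+ 1 ℚ./ suc k) ≡ x ℚ./ suc k
x/1*1/d≡x/d x k = begin
  ℚ.fromℚᵘ (ℚᵘ.mkℚᵘ x 0) ℚ.* ℚ.fromℚᵘ (ℚᵘ.mkℚᵘ (+ 1) k) ≡⟨ sym (fromℚᵘ-homo-* (ℚᵘ.mkℚᵘ x 0) (ℚᵘ.mkℚᵘ (+ 1) k)) ⟩
  ℚ.fromℚᵘ (ℚᵘ.mkℚᵘ x 0 ℚᵘ.* ℚᵘ.mkℚᵘ (+ 1) k)        ≡⟨ ℚP.fromℚᵘ-cong {ℚᵘ.mkℚᵘ x 0 ℚᵘ.* ℚᵘ.mkℚᵘ (+ 1) k} {ℚᵘ.mkℚᵘ x k} (ℚᵘ.*≡* (ℤP.*-assoc x (+ 1) (+ suc k))) ⟩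
  ℚ.fromℚᵘ (ℚᵘ.mkℚᵘ x k)                             ∎
  where open ≡-Reasoning

x/d≡z/1⇔x≡z*d : ∀ x z k → (x ℚ./ suc k ≡ z ℚ./ 1) ⇔ (x ≡ z ℤ.* + suc k)
x/d≡z/1⇔x≡z*d x z k = mk⇔
  (λ eq → case-≃ (ℚP./-injective-≃ (ℚᵘ.mkℚᵘ x k) (ℚᵘ.mkℚᵘ z 0) eq))
  (λ eq → ℚP.fromℚᵘ-cong {ℚᵘ.mkℚᵘ x k} {ℚᵘ.mkℚᵘ z 0} (ℚᵘ.*≡* (trans (ℤP.*-identityʳ x) eq)))
  where
  case-≃ : ℚᵘ.mkℚᵘ x k ℚᵘ.≃ ℚᵘ.mkℚᵘ z 0 → x ≡ z ℤ.* + suc k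
  case-≃ (ℚᵘ.*≡* eq) = trans (sym (ℤP.*-identityʳ x)) eq

∈𝓛-1/⇔∣ : ∀ {P Q} n d .{{_ : ℕ.NonZero d}} → (n ∈𝓛[ P , Q , + 1 ℚ./ d ]) ⇔ (+ d ℤS.∣ U P Q n)
∈𝓛-1/⇔∣ {P} {Q} n (suc k) = mk⇔
  (λ (z , e) → ℤS.divides z (to (x/d≡z/1⇔x≡z*d (U P Q n) z k) (trans (sym (x/1*1/d≡x/d (U P Q n) k)) e)))
  (λ (ℤS.divides z eq) → z , trans (x/1*1/d≡x/d (U P Q n) k) (from (x/d≡z/1⇔x≡z*d (U P Q n) z k) eq))

floor-spec : ∀ q → Σ ℕ λ s → s < ↧ₙ q × ↥ q ≡ + s ℤ.+ ℚ.floor q ℤ.* ↧ q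
floor-spec (mkℚ n d _) = n ℤDM.% + suc d , ℤDM.n%d<d n (+ suc d) , ℤDM.a≡a%n+[a/n]*n n (+ suc d)

ceiling-spec : ∀ q → Σ ℕ λ s → s < ↧ₙ q × ℚ.ceiling q ℤ.* ↧ q ≡ ↥ q ℤ.+ + s
ceiling-spec q@(mkℚ _ _ _) with floor-spec (ℚ.- q)
... | s , s<↧ₙ[-q] , ↥[-q]≡ = s , subst (s <_) (ℤP.+-injective (ℚP.↧-neg q)) s<↧ₙ[-q] , (begin
  ℤ.- f ℤ.* ↧ q                      ≡⟨ negate-spec (+ s) f (↧ q) ⟩
  ℤ.- (+ s ℤ.+ f ℤ.* ↧ q) ℤ.+ + s    ≡⟨ cong (λ y → ℤ.- (+ s ℤ.+ f ℤ.* y) ℤ.+ + s) (sym (ℚP.↧-neg q)) ⟩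
  ℤ.- (+ s ℤ.+ f ℤ.* ↧ (ℚ.- q)) ℤ.+ + s ≡⟨ cong (λ y → ℤ.- y ℤ.+ + s) (sym ↥[-q]≡) ⟩
  ℤ.- ↥ (ℚ.- q) ℤ.+ + s              ≡⟨ cong (λ y → ℤ.- y ℤ.+ + s) (ℚP.↥-neg q) ⟩
  ℤ.- (ℤ.- ↥ q) ℤ.+ + s              ≡⟨ cong (ℤ._+ + s) (ℤP.neg-involutive (↥ q)) ⟩
  ↥ q ℤ.+ + s                        ∎)
  where
  open ≡-Reasoning
  f = ℚ.floor (ℚ.- q)
  negate-spec : ∀ s f D → ℤ.- f ℤ.* D ≡ ℤ.- (s ℤ.+ f ℤ.* D) ℤ.+ s
  negate-spec = solve-∀

ceiling-/-spec : ∀ x a .{{_ : ℕ.NonZero a}} → Σ ℕ λ s → s < a × ℚ.ceiling (+ x ℚ./ a) ℤ.* + a ≡ + x ℤ.+ + s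
ceiling-/-spec x a with ceiling-spec (+ x ℚ./ a)
... | s , s<↧ₙq , c*↧q≡↥q+s = s * g , s*g<a , (begin
  c ℤ.* + a                   ≡⟨ cong (c ℤ.*_) (sym ↧q*g≡a) ⟩
  c ℤ.* (↧ q ℤ.* + g)         ≡⟨ sym (ℤP.*-assoc c (↧ q) (+ g)) ⟩
  c ℤ.* ↧ q ℤ.* + g           ≡⟨ cong (ℤ._* + g) c*↧q≡↥q+s ⟩
  (↥ q ℤ.+ + s) ℤ.* + g       ≡⟨ ℤP.*-distribʳ-+ (+ g) (↥ q) (+ s) ⟩
  ↥ q ℤ.* + g ℤ.+ + s ℤ.* + g ≡⟨ cong₂ ℤ._+_ ↥q*g≡x (sym (ℤP.pos-* s g)) ⟩
  + x ℤ.+ + (s * g)           ∎)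
  where
  open ≡-Reasoning
  q = + x ℚ./ a
  c = ℚ.ceiling q
  g = ℕG.gcd x a
  instance
    g≢0 : ℕ.NonZero g
    g≢0 = ℕ.≢-nonZero (ℕG.gcd[m,n]≢0 x a (inj₂ (ℕ.≢-nonZero⁻¹ a)))
  ↥q*g≡x : ↥ q ℤ.* + g ≡ + x
  ↥q*g≡x = ℚP.↥-/ (+ x) a
  ↧q*g≡a : ↧ q ℤ.* + g ≡ + a
  ↧q*g≡a = ℚP.↧-/ (+ x) a
  s*g<a : s * g < a
  s*g<a = subst (s * g <_) (ℤP.+-injective (trans (ℤP.pos-* (↧ₙ q) g) ↧q*g≡a)) (ℕP.*-monoˡ-< g s<↧ₙq)

≤⇔≤* : ∀ {m a x s} k → s < a → m * a ≡ x + s → (m ≤ k ⇔ x ≤ k * a)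
≤⇔≤* {m} {a} {x} {s} k s<a m*a≡x+s = mk⇔ m≤k⇒x≤k*a x≤k*a⇒m≤k
  where
  open ℕP.≤-Reasoning
  m≤k⇒x≤k*a : m ≤ k → x ≤ k * a
  m≤k⇒x≤k*a m≤k = begin
    x     ≤⟨ ℕP.m≤m+n x s ⟩
    x + s ≡⟨ sym m*a≡x+s ⟩
    m * a ≤⟨ ℕP.*-monoˡ-≤ a m≤k ⟩
    k * a ∎
  x≤k*a⇒m≤k : x ≤ k * a → m ≤ k
  x≤k*a⇒m≤k x≤k*a with m ℕ.≤? k
  ... | yes m≤k = m≤k
  ... | no m≰k = ⊥-elim (ℕP.<-irrefl refl (begin-strict
    suc k * a ≤⟨ ℕP.*-monoˡ-≤ a (ℕP.≰⇒> m≰k) ⟩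
    m * a     ≡⟨ m*a≡x+s ⟩
    x + s     <⟨ ℕP.+-monoʳ-< x s<a ⟩
    x + a     ≤⟨ ℕP.+-monoˡ-≤ a x≤k*a ⟩
    k * a + a ≡⟨ ℕP.+-comm (k * a) a ⟩
    suc k * a ∎))

ceiling-/≤⇔≤* : ∀ x a .{{_ : ℕ.NonZero a}} →
  Σ ℕ λ m → (+ m ≡ ℚ.ceiling (+ x ℚ./ a)) × (∀ k → m ≤ k ⇔ x ≤ k * a)
ceiling-/≤⇔≤* x a@(suc _) with ceiling-/-spec x a
... | s , s<a , c*a≡x+s with ℚ.ceiling (+ x ℚ./ a)
... | + m = m , refl , λ k → ≤⇔≤* k s<a (ℤP.+-injective (trans (ℤP.pos-* m a) c*a≡x+s))
... | -[1+ _ ] with () ← c*a≡x+s  -- c * a < 0 when c < 0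

prime^∣U⇔≤ : ∀ {p P Q P' Q'} a b r n → Prime p → ¬ (+ p ℤS.∣ P') → 2 * a < b →
  P ≡ + (p ^ a) ℤ.* P' → Q ≡ + (p ^ b) ℤ.* Q' →
  (+ (p ^ r) ℤS.∣ U P Q (suc n)) ⇔ (r ≤ a * n)
prime^∣U⇔≤ {p} {P} {Q} {P'} {Q'} a b r n pp p∤P' 2a<b P≡ Q≡ =
  ⇔.trans (mk⇔ ℤS.∣⇒∣ᵤ ℤS.∣ᵤ⇒∣)
    (subst (λ u → (p ^ r ℕD.∣ u) ⇔ (r ≤ a * n)) (sym ∣U∣≡) (prime^∣^*⇔≤ r (a * n) pp p∤∣W∣))
  where
  e = b ℕ.∸ suc (2 * a)
  b≡a+a+suc[e] : b ≡ a + a + suc e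
  b≡a+a+suc[e] = trans (sym (ℕP.m+[n∸m]≡n 2a<b)) (regroup a e)
    where
    regroup : ∀ a e → suc (2 * a) + e ≡ a + a + suc e
    regroup = ℕSolver.solve-∀
  T = (+ p) ℤ.^ suc e ℤ.* Q'
  W = U P' T (suc n)
  p∣T : + p ℤS.∣ T
  p∣T = ℤS.∣m⇒∣m*n Q' (ℤS.∣m⇒∣m*n ((+ p) ℤ.^ e) ℤS.∣-refl)
  p∤∣W∣ : ¬ (p ℕD.∣ ℤ.∣ W ∣)
  p∤∣W∣ p∣W = prime∤U pp p∤P' p∣T n (ℤS.∣ᵤ⇒∣ p∣W)
  P≡π^a*P' : P ≡ (+ p) ℤ.^ a ℤ.* P'
  P≡π^a*P' = trans P≡ (cong (ℤ._* P') (+-^ p a))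
  Q≡π^[a+a+suc[e]]*Q' : Q ≡ (+ p) ℤ.^ (a + a + suc e) ℤ.* Q'
  Q≡π^[a+a+suc[e]]*Q' = trans Q≡ (cong (ℤ._* Q') (trans (+-^ p b) (cong ((+ p) ℤ.^_) b≡a+a+suc[e])))
  ∣U∣≡ : ℤ.∣ U P Q (suc n) ∣ ≡ p ^ (a * n) * ℤ.∣ W ∣
  ∣U∣≡ = trans (cong ℤ.∣_∣ (U-pullout (+ p) a (suc e) P≡π^a*P' Q≡π^[a+a+suc[e]]*Q' n))
    (trans (ℤP.abs-* ((+ p) ℤ.^ (a * n)) W) (cong (λ k → ℤ.∣ k ∣ * ℤ.∣ W ∣) (sym (+-^ p (a * n)))))

≤*⇔+≤suc* : ∀ r a n → (r ≤ a * n) ⇔ (r + a ≤ suc n * a)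
≤*⇔+≤suc* r a n = mk⇔
  (λ r≤a*n → subst (r + a ≤_) a*n+a≡suc[n]*a (ℕP.+-monoˡ-≤ a r≤a*n))
  (λ r+a≤ → ℕP.+-cancelʳ-≤ a r (a * n) (subst (r + a ≤_) (sym a*n+a≡suc[n]*a) r+a≤))
  where
  a*n+a≡suc[n]*a : a * n + a ≡ suc n * a
  a*n+a≡suc[n]*a = trans (ℕP.+-comm (a * n) a) (cong (a ℕ.+_) (ℕP.*-comm a n))

≤⇔∈S[]-suc : ∀ m n → (m ≤ suc n) ⇔ (suc n ∈S[ m ])
≤⇔∈S[]-suc m n = mk⇔ inj₂ [ (λ ()) , (λ m≤suc[n] → m≤suc[n]) ]

theorem5p2 : (P Q : ℤ) → P ℤ.* Q ≢ + 0 →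
    (p : ℕ) (pp : Prime p) (a b : ℕ) (P' Q' : ℤ) →
    (ha : 1 ≤ a) → 1 ≤ b →
    P ≡ + (p ^ a) ℤ.* P' → Q ≡ + (p ^ b) ℤ.* Q' →
    ¬ ((+ p) ℤD.∣ (P' ℤ.* Q')) →
    2 * a < b →
    (r : ℕ) → 1 ≤ r →
    Σ ℕ λ m → (+ m ≡ ⌈ r + a / a ⌉[ ha ]) ×
    ((n : ℕ) → (n ∈𝓛[ P , Q , invPrimePow p pp r ]) ⇔ (n ∈S[ m ]))
theorem5p2 P Q _ p pp a b P' Q' ha _ P≡ Q≡ p∤P'Q' 2a<b r _
  with ceiling-/≤⇔≤* (r + a) a {{ℕ.>-nonZero ha}}
... | m , m≡⌈r+a/a⌉ , m≤⇔ = m , m≡⌈r+a/a⌉ , membership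
  where
  instance
    p^r≢0 : ℕ.NonZero (p ^ r)
    p^r≢0 = ℕP.m^n≢0 p r {{prime⇒nonZero pp}}
  p∤P' : ¬ (+ p ℤS.∣ P')
  p∤P' p∣P' = p∤P'Q' (ℤS.∣⇒∣ᵤ (ℤS.∣m⇒∣m*n Q' p∣P'))
  membership : ∀ n → (n ∈𝓛[ P , Q , invPrimePow p pp r ]) ⇔ (n ∈S[ m ])
  membership zero = mk⇔ (λ _ → inj₁ refl) (λ _ → from (∈𝓛-1/⇔∣ {P} {Q} 0 (p ^ r)) (ℤS.divides (+ 0) refl))
  membership (suc n) =
    ⇔.trans (∈𝓛-1/⇔∣ (suc n) (p ^ r)) (
    ⇔.trans (prime^∣U⇔≤ a b r n pp p∤P' 2a<b P≡ Q≡) (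
    ⇔.trans (≤*⇔+≤suc* r a n) (
    ⇔.trans (⇔.sym (m≤⇔ (suc n))) (≤⇔∈S[]-suc m n))))
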